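{- Let $\mathcal{C}$ be a decomposable class of graphs. Then $\mathcal{C}$ is intersectionwise $\chi$-guarding.
   Context: All graphs are finite and simple; graph classes are hereditary. The intersection (resp. union) of graphs $G_1,\dots,G_k$ is $(\bigcap V(G_i),\bigcap E(G_i))$ (resp. $(\bigcup V(G_i),\bigcup E(G_i))$). The graph-intersection of classes $\mathcal{G}_1,\dots,\mathcal{G}_k$ is the class of all graphs $G_1\cap\dots\cap G_k$ with $G_i\in\mathcal{G}_i$. A class is $\chi$-bounded if there is a non-decreasing $f:\mathbb{N}\to\mathbb{N}$ with $\chi(G)\le f(\omega(G))$ for all its members. A class $\mathcal{A}$ is intersectionwise $\chi$-guarding if for every $\chi$-bounded class $\mathcal{B}$ the graph-intersection of $\mathcal{A}$ and $\mathcal{B}$ is $\chi$-bounded. For an integer $r\ge 2$, a graph is componentwise $r$-dependent if every connected component has independence number at most $r-1$; the componentwise $r$-dependent chromatic number of $G$ is the least $k$ such that $V(G)$ can be partitioned into $k$ sets each inducing a componentwise $r$-dependent graph. A graph $G$ is $(t,k,r)$-decomposable if $G$ is the union of $t$ graphs each of componentwise $r$-dependent chromatic number at most $k$. A class $\mathcal{C}$ is decomposable if there exist positive integers $t,k,r$ (with $r\ge 2$) such that every graph in $\mathcal{C}$ is $(t,k,r)$-decomposable. -}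

module Defs where

open import Data.Nat using (ℕ; _≤_; _<_)
open import Data.Bool using (Bool; true; false; _∧_)
open import Data.Fin using (Fin)
open import Data.Product using (Σ; _×_; ∃; _,_)
open import Data.Empty using (⊥)
open import Relation.Nullary using (¬_)
open import Relation.Binary.PropositionalEquality using (_≡_; _≢_)
open import Function.Definitions using (Injective)

record Graph : Set where
  field
    V      : ℕ → Bool
    E      : ℕ → ℕ → Bool
    bound  : ℕ
    finite : ∀ x → V x ≡ true → x < bound
    E-V    : ∀ x y → E x y ≡ true → V x ≡ true
    E-sym  : ∀ x y → E x y ≡ E y x
    E-irr  : ∀ x → E x x ≡ false
open Graph public

_∈V_ : ℕ → Graph → Set
x ∈V G = V G x ≡ true

Adj : Graph → ℕ → ℕ → Set
Adj G x y = E G x y ≡ true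

IsInducedSubgraph : Graph → Graph → Set
IsInducedSubgraph H G =
  (∀ x → x ∈V H → x ∈V G) ×
  (∀ x y → x ∈V H → y ∈V H → E H x y ≡ E G x y)

Isomorphic : Graph → Graph → Set
Isomorphic G H =
  Σ (ℕ → ℕ) λ f → Σ (ℕ → ℕ) λ g →
    (∀ x → x ∈V G → f x ∈V H) ×
    (∀ y → y ∈V H → g y ∈V G) ×
    (∀ x → x ∈V G → g (f x) ≡ x) ×
    (∀ y → y ∈V H → f (g y) ≡ y) ×
    (∀ x y → x ∈V G → y ∈V G → E G x y ≡ E H (f x) (f y))

Hereditary : (Graph → Set) → Set
Hereditary 𝒞 = ∀ G H → 𝒞 G → IsInducedSubgraph H G → 𝒞 H

IsoClosed : (Graph → Set) → Set
IsoClosed 𝒞 = ∀ G H → 𝒞 G → Isomorphic G H → 𝒞 H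

IsGraphClass : (Graph → Set) → Set
IsGraphClass 𝒞 = Hereditary 𝒞 × IsoClosed 𝒞

IsIntersection : Graph → Graph → Graph → Set
IsIntersection G₁ G₂ H =
  (∀ x → V H x ≡ (V G₁ x ∧ V G₂ x)) ×
  (∀ x y → E H x y ≡ (E G₁ x y ∧ E G₂ x y))

GraphIntersection : (Graph → Set) → (Graph → Set) → Graph → Set
GraphIntersection 𝒜 ℬ H =
  Σ Graph λ G₁ → Σ Graph λ G₂ → 𝒜 G₁ × ℬ G₂ × IsIntersection G₁ G₂ H

IsUnion : (t : ℕ) → (Fin t → Graph) → Graph → Set
IsUnion t Gs G =
  (∀ x → (x ∈V G → Σ (Fin t) λ i → x ∈V Gs i) ×
         (Σ (Fin t) (λ i → x ∈V Gs i) → x ∈V G)) ×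
  (∀ x y → (Adj G x y → Σ (Fin t) λ i → Adj (Gs i) x y) ×
           (Σ (Fin t) (λ i → Adj (Gs i) x y) → Adj G x y))

HasClique : Graph → ℕ → Set
HasClique G w =
  Σ (Fin w → ℕ) λ h → Injective _≡_ _≡_ h ×
    (∀ i → h i ∈V G) × (∀ i j → i ≢ j → Adj G (h i) (h j))

IsCliqueNumber : Graph → ℕ → Set
IsCliqueNumber G w = HasClique G w × (∀ m → HasClique G m → m ≤ w)

Colourable : Graph → ℕ → Set
Colourable G k =
  Σ (ℕ → ℕ) λ c → (∀ x → x ∈V G → c x < k) ×
    (∀ x y → Adj G x y → c x ≢ c y)

NonDecreasing : (ℕ → ℕ) → Set
NonDecreasing f = ∀ m n → m ≤ n → f m ≤ f n

ChiBounded : (Graph → Set) → Set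
ChiBounded 𝒞 =
  Σ (ℕ → ℕ) λ f → NonDecreasing f ×
    (∀ G → 𝒞 G → ∀ w → IsCliqueNumber G w → Colourable G (f w))

IntersectionwiseChiGuarding : (Graph → Set) → Set₁
IntersectionwiseChiGuarding 𝒜 =
  ∀ (ℬ : Graph → Set) → IsGraphClass ℬ → ChiBounded ℬ →
    ChiBounded (GraphIntersection 𝒜 ℬ)

data WalkIn (G : Graph) (S : ℕ → Set) : ℕ → ℕ → Set where
  here : ∀ {x} → x ∈V G → S x → WalkIn G S x x
  step : ∀ {x y z} → x ∈V G → S x → Adj G x y → WalkIn G S y z → WalkIn G S x z

HasIndependentSetIn : Graph → (ℕ → Set) → ℕ → Set
HasIndependentSetIn G P r =
  Σ (Fin r → ℕ) λ h → Injective _≡_ _≡_ h ×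
    (∀ i → h i ∈V G) × (∀ i → P (h i)) ×
    (∀ i j → ¬ Adj G (h i) (h j))

-- The subgraph G[S] is componentwise r-dependent: every connected
-- component K of G[S] has α(K) ≤ r - 1, i.e. K has no independent set
-- of size r.  The component of x in G[S] is {y | there is a walk in G[S] from x to y}.
ComponentwiseDependentIn : ℕ → Graph → (ℕ → Set) → Set
ComponentwiseDependentIn r G S =
  ∀ x → x ∈V G → S x → ¬ HasIndependentSetIn G (λ y → WalkIn G S x y) r

CDColourable : ℕ → Graph → ℕ → Set
CDColourable r G k =
  Σ (ℕ → ℕ) λ c → (∀ x → x ∈V G → c x < k) ×
    (∀ i → ComponentwiseDependentIn r G (λ x → c x ≡ i))

Decomposable3 : ℕ → ℕ → ℕ → Graph → Set
Decomposable3 t k r G =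
  Σ (Fin t → Graph) λ Gs → IsUnion t Gs G × (∀ i → CDColourable r (Gs i) k)

DecomposableClass : (Graph → Set) → Set
DecomposableClass 𝒞 =
  Σ ℕ λ t → Σ ℕ λ k → Σ ℕ λ r →
    1 ≤ t × 1 ≤ k × 2 ≤ r × (∀ G → 𝒞 G → Decomposable3 t k r G)

-- Let H = G₁ ∩ G₂ with G₁ ∈ 𝒞 and G₂ ∈ ℬ, and write G₁ as the union of P₁, …, Pₜ, each with a
-- k-colouring cᵢ whose monochromatic components have no independent set of size r. Put
-- R = R(ω(H) + 1, r). For a monochromatic component K of Pᵢ, a clique of G₂[K] of size R
-- contains, by Ramsey's theorem for the edges of Pᵢ, either a clique of Pᵢ ∩ G₂ ⊆ H of size
-- ω(H) + 1 or an independent set of Pᵢ of size r inside K; both are impossible. So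
-- χ(G₂[K]) ≤ f(R), and x ↦ (cᵢ(x), colour of x in G₂[K]) properly colours Pᵢ ∩ G₂ with
-- k·f(R) colours. Every edge of H lies in some Pᵢ ∩ G₂, so the product of these t colourings,
-- with one extra colour for vertices outside Pᵢ, colours H with (k·f(R) + 1)ᵗ colours.
--
-- Constructively, the induced subgraphs G₂[K] need decidable components, and applying the
-- χ-bound of ℬ needs the clique number of G₂[K]; both are obtained by bounded search.

module Submission where

open import Defs
open import Data.Bool using (true; false; _∧_; if_then_else_)
open import Data.Bool.Properties using (∧-comm; ∧-zeroʳ) renaming (_≟_ to _≟ᵇ_)
open import Data.Fin using (Fin; zero; suc; fromℕ<)
open import Data.Fin.Properties using (all?; pigeonhole; fromℕ<-injective)
  renaming (_≟_ to _≟ᶠ_; <⇒≢ to <⇒≢ᶠ)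
open import Data.List using (List; []; _∷_; length; filter; tabulate; lookup)
open import Data.List.Properties using (length-tabulate)
open import Data.List.Membership.Propositional.Properties using (∈-lookup)
open import Data.List.Relation.Binary.Sublist.Propositional using (_⊆_; []; _∷_; _∷ʳ_; ⊆-trans)
open import Data.List.Relation.Binary.Sublist.Propositional.Properties
  using (All-resp-⊆; filter-⊆; []⊆-universal)
open import Data.List.Relation.Unary.All as All using (All; []; _∷_)
import Data.List.Relation.Unary.All.Properties as All
open import Data.List.Relation.Unary.AllPairs as AllPairs using (AllPairs; []; _∷_)
import Data.List.Relation.Unary.AllPairs.Properties as AllPairs
open import Data.List.Relation.Unary.Any using (here)
open import Data.List.Relation.Unary.Unique.Propositional using (Unique)
import Data.List.Relation.Unary.Unique.Propositional.Properties as Unique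
open import Data.Nat using (ℕ; zero; suc; _+_; _*_; _^_; _≤_; _<_; z≤n; s≤s; _≤?_)
open import Data.Nat.Properties
open import Data.Product using (∃; _×_; _,_; proj₁; proj₂)
open import Data.Sum using (_⊎_; inj₁; inj₂)
import Data.Vec.Functional as Vector
open import Function using (_∘_; id)
open import Function.Bundles using (_⇔_; mk⇔)
open import Function.Definitions using (Injective)
open import Relation.Binary.Definitions using (Symmetric; tri<; tri≈; tri>)
open import Relation.Binary.PropositionalEquality
  using (_≡_; _≢_; _≗_; refl; sym; trans; cong; cong₂; subst; subst₂; ≢-sym; module ≡-Reasoning)
open import Relation.Nullary using (¬_; Dec; yes; no; does; contradiction)
open import Relation.Nullary.Decidable
  using (map′; dec-true; does-⇔; ¬?; _×-dec_; _⊎-dec_; _→-dec_)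
open import Relation.Unary using (Decidable)
open import Relation.Unary.Properties using (∁?)

∧-elim : ∀ {a b} → a ∧ b ≡ true → a ≡ true × b ≡ true
∧-elim {true} b≡true = refl , b≡true

∧-intro : ∀ {a b} → a ≡ true → b ≡ true → a ∧ b ≡ true
∧-intro refl b≡true = b≡true

does-true⁻ : ∀ {P : Set} (P? : Dec P) → does P? ≡ true → P
does-true⁻ (yes p) _ = p

pair-<-mono : ∀ {m a a′ b b′} → a < m → b < b′ → a + m * b < a′ + m * b′
pair-<-mono {m} {a} {a′} {b} {b′} a<m b<b′ = begin-strict
  a + m * b    <⟨ +-monoˡ-< (m * b) a<m ⟩
  m + m * b    ≡⟨ *-suc m b ⟨
  m * suc b    ≤⟨ *-monoʳ-≤ m b<b′ ⟩
  m * b′       ≤⟨ m≤n+m (m * b′) a′ ⟩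
  a′ + m * b′  ∎
  where open ≤-Reasoning

pair-< : ∀ {m n a b} → a < m → b < n → a + m * b < m * n
pair-< = pair-<-mono {a′ = 0}

pair-injective : ∀ {m a a′ b b′} → a < m → a′ < m →
                 a + m * b ≡ a′ + m * b′ → a ≡ a′ × b ≡ b′
pair-injective {m} {a} {a′} {b} {b′} a<m a′<m eq with <-cmp b b′
... | tri< b<b′ _ _ = contradiction eq (<⇒≢ (pair-<-mono a<m b<b′))
... | tri≈ _ refl _ = +-cancelʳ-≡ (m * b) a a′ eq , refl
... | tri> _ _ b′<b = contradiction eq (≢-sym (<⇒≢ (pair-<-mono a′<m b′<b)))

code : ℕ → ∀ {t} → (Fin t → ℕ) → ℕ
code m {zero}  e = 0
code m {suc t} e = e zero + m * code m (e ∘ suc)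

code-< : ∀ {m t} (e : Fin t → ℕ) → (∀ i → e i < m) → code m e < m ^ t
code-< {t = zero}  e e<m = s≤s z≤n
code-< {t = suc t} e e<m = pair-< (e<m zero) (code-< (e ∘ suc) (e<m ∘ suc))

code-injective : ∀ {m t} (e e′ : Fin t → ℕ) → (∀ i → e i < m) → (∀ i → e′ i < m) →
                 code m e ≡ code m e′ → ∀ i → e i ≡ e′ i
code-injective e e′ e<m e′<m eq zero    = proj₁ (pair-injective (e<m zero) (e′<m zero) eq)
code-injective e e′ e<m e′<m eq (suc i) =
  code-injective (e ∘ suc) (e′ ∘ suc) (e<m ∘ suc) (e′<m ∘ suc)
    (proj₂ (pair-injective (e<m zero) (e′<m zero) eq)) i

nonDecreasing-suc : ∀ {f : ℕ → ℕ} → (∀ n → f n ≤ f (suc n)) → NonDecreasing f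
nonDecreasing-suc inc m zero    z≤n   = ≤-refl
nonDecreasing-suc inc m (suc n) m≤1+n with m≤n⇒m<n∨m≡n m≤1+n
... | inj₁ m<1+n = ≤-trans (nonDecreasing-suc inc m n (≤-pred m<1+n)) (inc n)
... | inj₂ refl  = ≤-refl

first : {P : ℕ → Set} → Decidable P → ℕ → ℕ
first P? zero    = zero
first P? (suc b) = if does (P? 0) then 0 else suc (first (P? ∘ suc) b)

first-satisfies : ∀ {P : ℕ → Set} (P? : Decidable P) {b x} → x < b → P x → P (first P? b)
first-satisfies P? {suc b} {x} x<b px with P? 0
... | yes p0 = p0
first-satisfies P? {suc b} {zero}  x<b px | no ¬p0 = contradiction px ¬p0
first-satisfies P? {suc b} {suc x} x<b px | no ¬p0 = first-satisfies (P? ∘ suc) (≤-pred x<b) px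

first-cong : ∀ {P Q : ℕ → Set} (P? : Decidable P) (Q? : Decidable Q) →
             (∀ n → P n ⇔ Q n) → ∀ b → first P? b ≡ first Q? b
first-cong P? Q? P⇔Q zero    = refl
first-cong P? Q? P⇔Q (suc b) rewrite does-⇔ (P⇔Q 0) (P? 0) (Q? 0) =
  cong (λ n → if does (Q? 0) then 0 else suc n) (first-cong (P? ∘ suc) (Q? ∘ suc) (P⇔Q ∘ suc) b)

count : {P : ℕ → Set} → Decidable P → ℕ → ℕ
count P? zero    = 0
count P? (suc b) = (if does (P? b) then suc else id) (count P? b)

count-≤ : ∀ {P : ℕ → Set} (P? : Decidable P) b → count P? b ≤ b
count-≤ P? zero    = z≤n
count-≤ P? (suc b) with does (P? b)
... | true  = s≤s (count-≤ P? b)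
... | false = m≤n⇒m≤1+n (count-≤ P? b)

count-mono : ∀ {P Q : ℕ → Set} (P? : Decidable P) (Q? : Decidable Q) →
             (∀ {x} → P x → Q x) → ∀ b → count P? b ≤ count Q? b
count-mono P? Q? P⊆Q zero    = z≤n
count-mono P? Q? P⊆Q (suc b) with P? b | Q? b
... | yes _  | yes _  = s≤s (count-mono P? Q? P⊆Q b)
... | no _   | yes _  = m≤n⇒m≤1+n (count-mono P? Q? P⊆Q b)
... | no _   | no _   = count-mono P? Q? P⊆Q b
... | yes pb | no ¬qb = contradiction (P⊆Q pb) ¬qb

count-mono-< : ∀ {P Q : ℕ → Set} (P? : Decidable P) (Q? : Decidable Q) →
               (∀ {x} → P x → Q x) → ∀ {b x} → x < b → ¬ P x → Q x →
               count P? b < count Q? b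
count-mono-< P? Q? P⊆Q {suc b} {x} x<b ¬px qx with m≤n⇒m<n∨m≡n (≤-pred x<b)
... | inj₂ refl with P? x | Q? x
...   | yes px | _      = contradiction px ¬px
...   | no _   | yes _  = s≤s (count-mono P? Q? P⊆Q b)
...   | no _   | no ¬qx = contradiction qx ¬qx
count-mono-< P? Q? P⊆Q {suc b} {x} x<b ¬px qx | inj₁ x<b′ with P? b | Q? b
... | yes _  | yes _  = s≤s (count-mono-< P? Q? P⊆Q x<b′ ¬px qx)
... | no _   | yes _  = m<n⇒m<1+n (count-mono-< P? Q? P⊆Q x<b′ ¬px qx)
... | no _   | no _   = count-mono-< P? Q? P⊆Q x<b′ ¬px qx
... | yes pb | no ¬qb = contradiction (P⊆Q pb) ¬qb

bounded-maximum : ∀ {P : ℕ → Set} → Decidable P → P 0 → ∀ b → (∀ n → P n → n ≤ b) →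
                  ∃ λ w → P w × (∀ n → P n → n ≤ w)
bounded-maximum P? p0 zero    ≤b = 0 , p0 , ≤b
bounded-maximum P? p0 (suc b) ≤b with P? (suc b)
... | yes pb = suc b , pb , ≤b
... | no ¬pb = bounded-maximum P? p0 b λ n pn → ≤-pred (≤∧≢⇒< (≤b n pn) λ { refl → ¬pb pn })

∃-bounded-function? : ∀ n b {P : (Fin n → ℕ) → Set} →
  (∀ {g h} → g ≗ h → P g → P h) → (∀ g → Dec (P g)) →
  Dec (∃ λ g → (∀ i → g i < b) × P g)
∃-bounded-function? zero b resp P? =
  map′ (λ p → Vector.[] , (λ ()) , p) (λ (g , _ , p) → resp (λ ()) p) (P? Vector.[])
∃-bounded-function? (suc n) b {P} resp P? = map′ cons uncons (anyUpTo? search-tail b)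
  where
  Below : ∀ {m} → (Fin m → ℕ) → Set
  Below g = ∀ i → g i < b

  cong-∷ : ∀ a {g h : Fin n → ℕ} → g ≗ h → (a Vector.∷ g) ≗ (a Vector.∷ h)
  cong-∷ a g≗h zero    = refl
  cong-∷ a g≗h (suc i) = g≗h i

  search-tail : ∀ a → Dec (∃ λ g → Below g × P (a Vector.∷ g))
  search-tail a = ∃-bounded-function? n b (resp ∘ cong-∷ a) (P? ∘ (a Vector.∷_))

  cons : (∃ λ a → a < b × ∃ λ g → Below g × P (a Vector.∷ g)) → ∃ λ g → Below g × P g
  cons (a , a<b , g , g<b , p) = a Vector.∷ g , (λ { zero → a<b ; (suc i) → g<b i }) , p

  uncons : (∃ λ g → Below g × P g) → ∃ λ a → a < b × ∃ λ g → Below g × P (a Vector.∷ g)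
  uncons (g , g<b , p) = g zero , g<b zero , g ∘ suc , g<b ∘ suc ,
                         resp (λ { zero → refl ; (suc i) → refl }) p

Adj-sym : ∀ G {x y} → Adj G x y → Adj G y x
Adj-sym G {x} {y} xy = trans (E-sym G y x) xy

Adj-∈V : ∀ G {x y} → Adj G x y → x ∈V G
Adj-∈V G {x} {y} = E-V G x y

Adj-irrefl : ∀ G {x} → ¬ Adj G x x
Adj-irrefl G {x} xx with () ← trans (sym xx) (E-irr G x)

IsSubgraph : Graph → Graph → Set
IsSubgraph G H = (∀ x → x ∈V G → x ∈V H) × (∀ x y → Adj G x y → Adj H x y)

HasClique-mono : ∀ {G H n} → IsSubgraph G H → HasClique G n → HasClique H n
HasClique-mono (V⊆ , E⊆) (h , inj , h∈V , adj) =
  h , inj , (λ i → V⊆ _ (h∈V i)) , (λ i j i≢j → E⊆ _ _ (adj i j i≢j))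

¬HasClique-suc : ∀ {G H w} → (∀ m → HasClique H m → m ≤ w) → IsSubgraph G H →
                 ¬ HasClique G (suc w)
¬HasClique-suc {G} {H} {w} ω≤w G⊆H clique =
  n≮n w (ω≤w (suc w) (HasClique-mono {G} {H} G⊆H clique))

Colourable-mono : ∀ {G a b} → a ≤ b → Colourable G a → Colourable G b
Colourable-mono a≤b (c , c<a , proper) = c , (λ x x∈V → ≤-trans (c<a x x∈V) a≤b) , proper

_[_] : (G : Graph) {P : ℕ → Set} → Decidable P → Graph
G [ P? ] = record
  { V      = λ x → does (P? x) ∧ V G x
  ; E      = λ x y → (does (P? x) ∧ does (P? y)) ∧ E G x y
  ; bound  = bound G
  ; finite = λ x x∈V → finite G x (proj₂ (∧-elim x∈V))
  ; E-V    = λ x y xy → let (pxy , Gxy) = ∧-elim xy in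
                         ∧-intro (proj₁ (∧-elim pxy)) (E-V G x y Gxy)
  ; E-sym  = λ x y → cong₂ _∧_ (∧-comm (does (P? x)) (does (P? y))) (E-sym G x y)
  ; E-irr  = λ x → trans (cong (_ ∧_) (E-irr G x)) (∧-zeroʳ _)
  }

module _ (G : Graph) {P : ℕ → Set} (P? : Decidable P) where

  ∈V-induced⁻ : ∀ {x} → x ∈V (G [ P? ]) → P x × x ∈V G
  ∈V-induced⁻ {x} x∈V = let (px , x∈G) = ∧-elim x∈V in does-true⁻ (P? x) px , x∈G

  ∈V-induced⁺ : ∀ {x} → P x → x ∈V G → x ∈V (G [ P? ])
  ∈V-induced⁺ {x} px = ∧-intro (dec-true (P? x) px)

  Adj-induced⁻ : ∀ {x y} → Adj (G [ P? ]) x y → Adj G x y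
  Adj-induced⁻ xy = proj₂ (∧-elim xy)

  Adj-induced⁺ : ∀ {x y} → P x → P y → Adj G x y → Adj (G [ P? ]) x y
  Adj-induced⁺ {x} {y} px py = ∧-intro (∧-intro (dec-true (P? x) px) (dec-true (P? y) py))

  induced-isInducedSubgraph : IsInducedSubgraph (G [ P? ]) G
  induced-isInducedSubgraph = (λ x x∈V → proj₂ (∈V-induced⁻ x∈V)) , E≡
    where
    E≡ : ∀ x y → x ∈V (G [ P? ]) → y ∈V (G [ P? ]) → E (G [ P? ]) x y ≡ E G x y
    E≡ x y x∈V y∈V = cong₂ (λ a b → (a ∧ b) ∧ E G x y) (proj₁ (∧-elim {does (P? x)} x∈V))
                                                            (proj₁ (∧-elim {does (P? y)} y∈V))

_∩_ : Graph → Graph → Graph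
G ∩ G′ = record
  { V      = λ x → V G x ∧ V G′ x
  ; E      = λ x y → E G x y ∧ E G′ x y
  ; bound  = bound G
  ; finite = λ x x∈V → finite G x (proj₁ (∧-elim x∈V))
  ; E-V    = λ x y xy → let (xy₁ , xy₂) = ∧-elim xy in ∧-intro (E-V G x y xy₁) (E-V G′ x y xy₂)
  ; E-sym  = λ x y → cong₂ _∧_ (E-sym G x y) (E-sym G′ x y)
  ; E-irr  = λ x → cong₂ _∧_ (E-irr G x) (E-irr G′ x)
  }

IsUnion-⊇ : ∀ {t Gs G} → IsUnion t Gs G → ∀ i → IsSubgraph (Gs i) G
IsUnion-⊇ (V≡ , E≡) i = (λ x x∈V → proj₂ (V≡ x) (i , x∈V)) , (λ x y xy → proj₂ (E≡ x y) (i , xy))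

IsIntersection-⊇ : ∀ {G G₁ G₂ H} → IsIntersection G₁ G₂ H → IsSubgraph G G₁ →
                   IsSubgraph (G ∩ G₂) H
IsIntersection-⊇ {G} (V≡ , E≡) (V⊆ , E⊆) =
  (λ x x∈V → let (x∈G , x∈G₂) = ∧-elim {V G x} x∈V in
              trans (V≡ x) (∧-intro (V⊆ x x∈G) x∈G₂)) ,
  (λ x y xy → let (xy∈G , xy∈G₂) = ∧-elim {E G x y} xy in
              trans (E≡ x y) (∧-intro (E⊆ x y xy∈G) xy∈G₂))

union-intersection-covers : ∀ {t Gs G₁ G₂ H} → IsUnion t Gs G₁ → IsIntersection G₁ G₂ H →
                            ∀ x y → Adj H x y → ∃ λ i → Adj (Gs i ∩ G₂) x y
union-intersection-covers {G₁ = G₁} (_ , E≡⋃) (_ , E≡∩) x y xy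
  with xy∈G₁ , xy∈G₂ ← ∧-elim {E G₁ x y} (trans (sym (E≡∩ x y)) xy)
  with i , xy∈Gᵢ ← proj₁ (E≡⋃ x y) xy∈G₁ = i , ∧-intro xy∈Gᵢ xy∈G₂

module _ (G : Graph) where

  IsClique : ∀ {n} → (Fin n → ℕ) → Set
  IsClique h = Injective _≡_ _≡_ h × (∀ i → h i ∈V G) × (∀ i j → i ≢ j → Adj G (h i) (h j))

  isClique? : ∀ {n} (h : Fin n → ℕ) → Dec (IsClique h)
  isClique? h = injective? ×-dec all? (λ i → V G (h i) ≟ᵇ true) ×-dec
                all? (λ i → all? λ j → ¬? (i ≟ᶠ j) →-dec E G (h i) (h j) ≟ᵇ true)
    where
    injective? : Dec (Injective _≡_ _≡_ h)
    injective? = map′ (λ inj {i} {j} → inj i j) (λ inj i j → inj)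
                      (all? λ i → all? λ j → h i ≟ h j →-dec i ≟ᶠ j)

  IsClique-resp : ∀ {n} {g h : Fin n → ℕ} → g ≗ h → IsClique g → IsClique h
  IsClique-resp g≗h (inj , g∈V , adj) =
    (λ {i} {j} hi≡hj → inj (trans (g≗h i) (trans hi≡hj (sym (g≗h j))))) ,
    (λ i → subst (_∈V G) (g≗h i) (g∈V i)) ,
    (λ i j i≢j → subst₂ (Adj G) (g≗h i) (g≗h j) (adj i j i≢j))

  clique-size-≤ : ∀ {n} → HasClique G n → n ≤ bound G
  clique-size-≤ {n} (h , inj , h∈V , _) with n ≤? bound G
  ... | yes n≤b = n≤b
  ... | no n≰b
    with i , j , i<j , eq ← pigeonhole (≰⇒> n≰b) (λ i → fromℕ< (finite G (h i) (h∈V i)))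
    = contradiction (inj (fromℕ<-injective (h i) (h j) _ _ eq)) (<⇒≢ᶠ i<j)

  hasClique? : ∀ n → Dec (HasClique G n)
  hasClique? n = map′ (λ (h , _ , c) → h , c)
                      (λ (h , c) → h , (λ i → finite G (h i) (proj₁ (proj₂ c) i)) , c)
                      (∃-bounded-function? n (bound G) IsClique-resp isClique?)

  cliqueNumber : ∃ (IsCliqueNumber G)
  cliqueNumber = bounded-maximum hasClique? (Vector.[] , (λ { {()} }) , (λ ()) , (λ ()))
                                 (bound G) (λ _ → clique-size-≤)

-- Ramsey's theorem

ram : ℕ → ℕ → ℕ
ram zero    _       = 0
ram (suc a) zero    = 0
ram (suc a) (suc b) = suc (ram a (suc b) + ram (suc a) b)

ram-monoˡ : ∀ b → NonDecreasing (λ a → ram a b)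
ram-monoˡ b = nonDecreasing-suc (λ a → ram-suc-≤ a b)
  where
  ram-suc-≤ : ∀ a b → ram a b ≤ ram (suc a) b
  ram-suc-≤ zero    _       = z≤n
  ram-suc-≤ (suc a) zero    = z≤n
  ram-suc-≤ (suc a) (suc c) = s≤s (+-mono-≤ (ram-suc-≤ a (suc c)) (ram-suc-≤ (suc a) c))

length-filter-∁ : ∀ {A : Set} {P : A → Set} (P? : Decidable P) xs →
                  length (filter P? xs) + length (filter (∁? P?) xs) ≡ length xs
length-filter-∁ P? []       = refl
length-filter-∁ P? (x ∷ xs) with P? x
... | yes _ = cong suc (length-filter-∁ P? xs)
... | no _  = trans (+-suc _ _) (cong suc (length-filter-∁ P? xs))

module _ {A : Set} {R : A → A → Set} (R? : ∀ x y → Dec (R x y)) where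

  Homogeneous : (A → A → Set) → ℕ → List A → Set
  Homogeneous Q n xs = ∃ λ ys → ys ⊆ xs × length ys ≡ n × AllPairs Q ys

  ramsey : ∀ a b xs → ram a b ≤ length xs →
           Homogeneous R a xs ⊎ Homogeneous (λ x y → ¬ R x y) b xs
  ramsey zero    b       xs _ = inj₁ ([] , []⊆-universal xs , refl , [])
  ramsey (suc a) zero    xs _ = inj₂ ([] , []⊆-universal xs , refl , [])
  ramsey (suc a) (suc b) (x ∷ xs) (s≤s ram≤) = split (ram a (suc b) ≤? length related)
    where
    related unrelated : List A
    related   = filter (R? x) xs
    unrelated = filter (∁? (R? x)) xs

    Outcome : ℕ → ℕ → List A → Set
    Outcome a b xs = Homogeneous R a xs ⊎ Homogeneous (λ x y → ¬ R x y) b xs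

    extend₁ : Outcome a (suc b) related → Outcome (suc a) (suc b) (x ∷ xs)
    extend₁ (inj₁ (ys , ys⊆ , refl , hom)) =
      inj₁ (x ∷ ys , refl ∷ ⊆-trans ys⊆ (filter-⊆ (R? x) xs) , refl ,
            All-resp-⊆ ys⊆ (All.all-filter (R? x) xs) ∷ hom)
    extend₁ (inj₂ (ys , ys⊆ , len , hom)) =
      inj₂ (ys , x ∷ʳ ⊆-trans ys⊆ (filter-⊆ (R? x) xs) , len , hom)

    extend₂ : Outcome (suc a) b unrelated → Outcome (suc a) (suc b) (x ∷ xs)
    extend₂ (inj₁ (ys , ys⊆ , len , hom)) =
      inj₁ (ys , x ∷ʳ ⊆-trans ys⊆ (filter-⊆ (∁? (R? x)) xs) , len , hom)
    extend₂ (inj₂ (ys , ys⊆ , refl , hom)) =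
      inj₂ (x ∷ ys , refl ∷ ⊆-trans ys⊆ (filter-⊆ (∁? (R? x)) xs) , refl ,
            All-resp-⊆ ys⊆ (All.all-filter (∁? (R? x)) xs) ∷ hom)

    enough-unrelated : ¬ ram a (suc b) ≤ length related → ram (suc a) b ≤ length unrelated
    enough-unrelated few = +-cancelˡ-≤ (ram a (suc b)) _ _ (begin
      ram a (suc b) + ram (suc a) b      ≤⟨ ram≤ ⟩
      length xs                          ≡⟨ length-filter-∁ (R? x) xs ⟨
      length related + length unrelated  ≤⟨ +-monoˡ-≤ _ (<⇒≤ (≰⇒> few)) ⟩
      ram a (suc b) + length unrelated   ∎)
      where open ≤-Reasoning

    split : Dec (ram a (suc b) ≤ length related) → Outcome (suc a) (suc b) (x ∷ xs)
    split (yes enough) = extend₁ (ramsey a (suc b) related enough)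
    split (no few)     = extend₂ (ramsey (suc a) b unrelated (enough-unrelated few))

AllPairs-resp-⊆ : ∀ {A : Set} {R : A → A → Set} {xs ys} → ys ⊆ xs → AllPairs R xs →
                  AllPairs R ys
AllPairs-resp-⊆ []         []         = []
AllPairs-resp-⊆ (_ ∷ʳ τ)   (_ ∷ pxs)  = AllPairs-resp-⊆ τ pxs
AllPairs-resp-⊆ (refl ∷ τ) (px ∷ pxs) = All-resp-⊆ τ px ∷ AllPairs-resp-⊆ τ pxs

lookup-AllPairs : ∀ {A : Set} {R : A → A → Set} → Symmetric R → ∀ {xs} → AllPairs R xs →
                  ∀ {i j} → i ≢ j → R (lookup xs i) (lookup xs j)
lookup-AllPairs sym (px ∷ pxs) {zero}  {zero}  i≢j = contradiction refl i≢j
lookup-AllPairs sym (px ∷ pxs) {zero}  {suc j} _   = All.lookup px (∈-lookup j)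
lookup-AllPairs sym (px ∷ pxs) {suc i} {zero}  _   = sym (All.lookup px (∈-lookup i))
lookup-AllPairs sym (px ∷ pxs) {suc i} {suc j} i≢j = lookup-AllPairs sym pxs (i≢j ∘ cong suc)

lookup-injective : ∀ {A : Set} {xs : List A} → Unique xs → Injective _≡_ _≡_ (lookup xs)
lookup-injective u {i} {j} eq with i ≟ᶠ j
... | yes i≡j = i≡j
... | no i≢j  = contradiction eq (lookup-AllPairs ≢-sym u i≢j)

module _ (G : Graph) where

  IsCliqueList : List ℕ → Set
  IsCliqueList xs = Unique xs × All (_∈V G) xs × AllPairs (Adj G) xs

  clique-toList : ∀ {n} → HasClique G n → ∃ λ xs → length xs ≡ n × IsCliqueList xs
  clique-toList (h , inj , h∈V , adj) =
    tabulate h , length-tabulate h ,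
    Unique.tabulate⁺ inj , All.tabulate⁺ h∈V , AllPairs.tabulate⁺ (adj _ _)

  clique-fromList : ∀ {xs} → IsCliqueList xs → HasClique G (length xs)
  clique-fromList {xs} (u , xs∈V , adj) =
    lookup xs , lookup-injective u , (λ i → All.lookup xs∈V (∈-lookup i)) ,
    (λ i j → lookup-AllPairs (Adj-sym G) adj)

  independent-fromList : ∀ {P : ℕ → Set} {xs} → Unique xs → All (λ x → x ∈V G × P x) xs →
                         AllPairs (λ x y → ¬ Adj G x y) xs → HasIndependentSetIn G P (length xs)
  independent-fromList {P} {xs} u xs∈ nonadj =
    lookup xs , lookup-injective u , proj₁ ∘ member , proj₂ ∘ member , nonadj′
    where
    member : ∀ i → lookup xs i ∈V G × P (lookup xs i)
    member i = All.lookup xs∈ (∈-lookup i)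
    nonadj′ : ∀ i j → ¬ Adj G (lookup xs i) (lookup xs j)
    nonadj′ i j with i ≟ᶠ j
    ... | yes refl = Adj-irrefl G
    ... | no i≢j   = lookup-AllPairs (λ ¬xy yx → ¬xy (Adj-sym G yx)) nonadj i≢j

-- Monochromatic components

module _ {G : Graph} {S : ℕ → Set} where

  walk-start : ∀ {x y} → WalkIn G S x y → x ∈V G × S x
  walk-start (here x∈V sx)     = x∈V , sx
  walk-start (step x∈V sx _ _) = x∈V , sx

  walk-end : ∀ {x y} → WalkIn G S x y → y ∈V G × S y
  walk-end (here y∈V sy)  = y∈V , sy
  walk-end (step _ _ _ w) = walk-end w

  walk-snoc : ∀ {x y z} → WalkIn G S x y → Adj G y z → S z → WalkIn G S x z
  walk-snoc (here y∈V sy)       yz sz = step y∈V sy yz (here (Adj-∈V G (Adj-sym G yz)) sz)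
  walk-snoc (step x∈V sx xu w) yz sz = step x∈V sx xu (walk-snoc w yz sz)

module Reachability (G : Graph) {S : ℕ → Set} (S? : Decidable S) where

  Inside : ℕ → Set
  Inside x = x ∈V G × S x

  inside? : Decidable Inside
  inside? x = V G x ≟ᵇ true ×-dec S? x

  -- ReachWithin n y x: some walk in G[S] from x to y has at most n steps.
  ReachWithin : ℕ → ℕ → ℕ → Set
  ReachWithin zero    y x = Inside x × x ≡ y
  ReachWithin (suc n) y x =
    ReachWithin n y x ⊎ (Inside x × ∃ λ u → u < bound G × Adj G x u × ReachWithin n y u)

  reachWithin? : ∀ n y → Decidable (ReachWithin n y)
  reachWithin? zero    y x = inside? x ×-dec x ≟ y
  reachWithin? (suc n) y x = reachWithin? n y x ⊎-dec (inside? x ×-dec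
    anyUpTo? (λ u → E G x u ≟ᵇ true ×-dec reachWithin? n y u) (bound G))

  reachWithin⇒walk : ∀ {n x y} → ReachWithin n y x → WalkIn G S x y
  reachWithin⇒walk {zero}  ((x∈V , sx) , refl) = here x∈V sx
  reachWithin⇒walk {suc n} (inj₁ r)            = reachWithin⇒walk r
  reachWithin⇒walk {suc n} (inj₂ ((x∈V , sx) , _ , _ , xu , r)) =
    step x∈V sx xu (reachWithin⇒walk r)

  reachWithin-refl : ∀ {n y} → Inside y → ReachWithin n y y
  reachWithin-refl {zero}  iy = iy , refl
  reachWithin-refl {suc n} iy = inj₁ (reachWithin-refl iy)

  Stable : ℕ → ℕ → Set
  Stable y n = ∀ x → ReachWithin (suc n) y x → ReachWithin n y x

  stable-suc : ∀ {y n} → Stable y n → Stable y (suc n)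
  stable-suc st x (inj₁ r)                       = r
  stable-suc st x (inj₂ (ix , u , u<b , xu , r)) = inj₂ (ix , u , u<b , xu , st u r)

  -- Every round that is not yet stable adds a new vertex below bound G, so the rounds
  -- are stable from bound G + 1 on.
  grows-or-stable : ∀ y n → n ≤ count (reachWithin? n y) (bound G) ⊎ Stable y n
  grows-or-stable y zero    = inj₁ z≤n
  grows-or-stable y (suc n) with grows-or-stable y n
  ... | inj₂ st = inj₂ (stable-suc st)
  ... | inj₁ n≤count
    with anyUpTo? (λ x → reachWithin? (suc n) y x ×-dec ¬? (reachWithin? n y x)) (bound G)
  ...   | yes (x , x<b , new , ¬old) = inj₁ (≤-trans (s≤s n≤count)
          (count-mono-< (reachWithin? n y) (reachWithin? (suc n) y) inj₁ x<b ¬old new))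
  ...   | no noneNew = inj₂ (stable-suc st)
    where
    st : Stable y n
    st x r with reachWithin? n y x
    ... | yes old = old
    ... | no ¬old =
      contradiction (x , finite G x (proj₁ (walk-start (reachWithin⇒walk r))) , r , ¬old) noneNew

  stable : ∀ y → Stable y (suc (bound G))
  stable y with grows-or-stable y (suc (bound G))
  ... | inj₂ st  = st
  ... | inj₁ big =
    contradiction (≤-trans big (count-≤ (reachWithin? _ y) (bound G))) (n≮n (bound G))

  walk⇒reachWithin : ∀ {x y} → WalkIn G S x y → ReachWithin (suc (bound G)) y x
  walk⇒reachWithin (here y∈V sy)       = reachWithin-refl (y∈V , sy)
  walk⇒reachWithin (step x∈V sx xu w) = stable _ _
    (inj₂ ((x∈V , sx) , _ , finite G _ (proj₁ (walk-start w)) , xu , walk⇒reachWithin w))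

  walk? : ∀ x y → Dec (WalkIn G S x y)
  walk? x y = map′ reachWithin⇒walk walk⇒reachWithin (reachWithin? (suc (bound G)) y x)

module Components (G : Graph) (c : ℕ → ℕ) where

  Component : ℕ → ℕ → Set
  Component z = WalkIn G (λ x → c x ≡ c z) z

  component? : ∀ z → Decidable (Component z)
  component? z = Reachability.walk? G (λ x → c x ≟ c z) z

  -- The colourings of the graphs G′ [ component? z ] are chosen separately for each z, so
  -- every component needs one canonical name: its least vertex.
  rep : ℕ → ℕ
  rep x = first (λ z → component? z x) (bound G)

  component-rep : ∀ {x} → x ∈V G → Component (rep x) x
  component-rep {x} x∈V = first-satisfies (λ z → component? z x) (finite G x x∈V) (here x∈V refl)

  rep-cong : ∀ {x y} → Adj G x y → c x ≡ c y → rep x ≡ rep y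
  rep-cong xy cx≡cy =
    first-cong _ _ (λ z → mk⇔ (extend xy cx≡cy) (extend (Adj-sym G xy) (sym cx≡cy))) (bound G)
    where
    extend : ∀ {z u v} → Adj G u v → c u ≡ c v → Component z u → Component z v
    extend uv cu≡cv w = walk-snoc w uv (trans (sym cu≡cv) (proj₂ (walk-end w)))

colourable-⋃ : ∀ {t K} (H : Graph) (Hs : Fin t → Graph) →
               (∀ x y → Adj H x y → ∃ λ i → Adj (Hs i) x y) →
               (∀ i → Colourable (Hs i) K) → Colourable H (suc K ^ t)
colourable-⋃ {t} {K} H Hs covers colourings =
  colour , (λ x _ → code-< (label x) (label< x)) , proper
  where
  c : Fin t → ℕ → ℕ
  c i = proj₁ (colourings i)

  -- c i is bounded only on the vertices of Hs i; colour 0 is kept for all other vertices.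
  label : ℕ → Fin t → ℕ
  label x i = if V (Hs i) x then suc (c i x) else 0

  label< : ∀ x i → label x i < suc K
  label< x i with V (Hs i) x in x∈V
  ... | true  = s≤s (proj₁ (proj₂ (colourings i)) x x∈V)
  ... | false = s≤s z≤n

  label-∈V : ∀ {x i} → x ∈V Hs i → label x i ≡ suc (c i x)
  label-∈V x∈V rewrite x∈V = refl

  colour : ℕ → ℕ
  colour x = code (suc K) (label x)

  proper : ∀ x y → Adj H x y → colour x ≢ colour y
  proper x y xy eq with i , xy∈Hs ← covers x y xy =
    proj₂ (proj₂ (colourings i)) x y xy∈Hs (suc-injective (begin
      suc (c i x)  ≡⟨ label-∈V (Adj-∈V (Hs i) xy∈Hs) ⟨
      label x i    ≡⟨ code-injective (label x) (label y) (label< x) (label< y) eq i ⟩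
      label y i    ≡⟨ label-∈V (Adj-∈V (Hs i) (Adj-sym (Hs i) xy∈Hs)) ⟩
      suc (c i y)  ∎))
    where open ≡-Reasoning

module _ (G G′ : Graph) (c : ℕ → ℕ) where

  open Components G c

  colourable-∩ : ∀ {k F} → (∀ x → x ∈V G → c x < k) →
                 (∀ z → Colourable (G′ [ component? z ]) F) → Colourable (G ∩ G′) (k * F)
  colourable-∩ {k} {F} c<k colourable-component = colour , colour< , proper
    where
    d : ℕ → ℕ → ℕ
    d z = proj₁ (colourable-component z)

    colour : ℕ → ℕ
    colour x = c x + k * d (rep x) x

    colour< : ∀ x → x ∈V (G ∩ G′) → colour x < k * F
    colour< x x∈V with x∈G , x∈G′ ← ∧-elim {V G x} x∈V =
      pair-< (c<k x x∈G) (proj₁ (proj₂ (colourable-component (rep x))) x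
                           (∈V-induced⁺ G′ (component? (rep x)) (component-rep x∈G) x∈G′))

    proper : ∀ x y → Adj (G ∩ G′) x y → colour x ≢ colour y
    proper x y xy eq with xy∈G , xy∈G′ ← ∧-elim {E G x y} xy =
      proj₂ (proj₂ (colourable-component (rep x))) x y xy∈component dx≡dy
      where
      x∈G : x ∈V G
      x∈G = Adj-∈V G xy∈G
      y∈G : y ∈V G
      y∈G = Adj-∈V G (Adj-sym G xy∈G)
      same-colour : c x ≡ c y × d (rep x) x ≡ d (rep y) y
      same-colour = pair-injective (c<k x x∈G) (c<k y y∈G) eq
      same-rep : rep x ≡ rep y
      same-rep = rep-cong xy∈G (proj₁ same-colour)
      xy∈component : Adj (G′ [ component? (rep x) ]) x y
      xy∈component = Adj-induced⁺ G′ (component? (rep x)) (component-rep x∈G)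
        (subst (λ z → Component z y) (sym same-rep) (component-rep y∈G)) xy∈G′
      dx≡dy : d (rep x) x ≡ d (rep x) y
      dx≡dy = trans (proj₂ same-colour) (cong (λ z → d z y) (sym same-rep))

  -- 1 ≤ r makes the independent set found by Ramsey's theorem nonempty, which shows z ∈V G.
  ¬HasClique-component : ∀ {r w} → 1 ≤ r → (∀ j → ComponentwiseDependentIn r G (λ x → c x ≡ j)) →
    ¬ HasClique (G ∩ G′) (suc w) → ∀ z n → ram (suc w) r ≤ n → ¬ HasClique (G′ [ component? z ]) n
  ¬HasClique-component {r} {w} 1≤r dependent no-clique z n big clique
    with xs , refl , unique , xs∈V , adj ← clique-toList (G′ [ component? z ]) clique
    with ramsey (λ x y → E G x y ≟ᵇ true) (suc w) r xs big
  ... | inj₁ (ys , ys⊆ , len , adjG) =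
    no-clique (subst (HasClique (G ∩ G′)) len (clique-fromList (G ∩ G′)
      (AllPairs-resp-⊆ ys⊆ unique ,
       All.map (λ (zy , y∈G′) → ∧-intro (proj₁ (walk-end zy)) y∈G′) (All-resp-⊆ ys⊆ members) ,
       AllPairs.zipWith (λ (a , b) → ∧-intro a b)
         (adjG , AllPairs-resp-⊆ ys⊆ (AllPairs.map (Adj-induced⁻ G′ (component? z)) adj)))))
    where
    members : All (λ y → Component z y × y ∈V G′) xs
    members = All.map (∈V-induced⁻ G′ (component? z)) xs∈V
  ... | inj₂ ([] , _ , len , _) = contradiction (subst (1 ≤_) (sym len) 1≤r) λ ()
  ... | inj₂ (ys@(y ∷ _) , ys⊆ , len , nonadj) =
    dependent (c z) z (proj₁ (walk-start zy)) refl
      (subst (HasIndependentSetIn G (Component z)) len (independent-fromList G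
        (AllPairs-resp-⊆ ys⊆ unique)
        (All.map (λ (zy , _) → proj₁ (walk-end zy) , zy) (All-resp-⊆ ys⊆ members))
        nonadj))
    where
    members : All (λ y → Component z y × y ∈V G′) xs
    members = All.map (∈V-induced⁻ G′ (component? z)) xs∈V
    zy : Component z y
    zy = proj₁ (All.lookup (All-resp-⊆ ys⊆ members) (here refl))

module _ {ℬ : Graph → Set} (hereditary : Hereditary ℬ) (f : ℕ → ℕ) (f-mono : NonDecreasing f)
         (χ≤f : ∀ G → ℬ G → ∀ w → IsCliqueNumber G w → Colourable G (f w)) where

  colourable-cliquesBelow : ∀ {G m} → ℬ G → (∀ n → m ≤ n → ¬ HasClique G n) → Colourable G (f m)
  colourable-cliquesBelow {G} {m} G∈ℬ no-clique with ω , ω-clique , ω-max ← cliqueNumber G =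
    Colourable-mono {G} (f-mono ω m (<⇒≤ (≰⇒> λ m≤ω → no-clique ω m≤ω ω-clique)))
                    (χ≤f G G∈ℬ ω (ω-clique , ω-max))

  colourable-∩-ℬ : ∀ {r k w} (G G′ : Graph) → ℬ G′ → 1 ≤ r → CDColourable r G k →
                   ¬ HasClique (G ∩ G′) (suc w) → Colourable (G ∩ G′) (k * f (ram (suc w) r))
  colourable-∩-ℬ G G′ G′∈ℬ 1≤r (c , c<k , dependent) no-clique =
    colourable-∩ G G′ c c<k λ z →
      colourable-cliquesBelow
        (hereditary G′ (G′ [ component? z ]) G′∈ℬ (induced-isInducedSubgraph G′ (component? z)))
        (¬HasClique-component G G′ c 1≤r dependent no-clique z)
    where open Components G c

  colourable-decomposable-∩-ℬ : ∀ {t k r w G₁ G₂ H} → 1 ≤ r → Decomposable3 t k r G₁ → ℬ G₂ →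
    IsIntersection G₁ G₂ H → (∀ m → HasClique H m → m ≤ w) →
    Colourable H (suc (k * f (ram (suc w) r)) ^ t)
  colourable-decomposable-∩-ℬ {k = k} {G₁ = G₁} {G₂} {H} 1≤r (Gs , G₁≡⋃Gs , cd) G₂∈ℬ H≡G₁∩G₂ ω≤w =
    colourable-⋃ H (λ i → Gs i ∩ G₂) covers λ i →
      colourable-∩-ℬ {k = k} (Gs i) G₂ G₂∈ℬ 1≤r (cd i)
        (¬HasClique-suc {Gs i ∩ G₂} {H} ω≤w (piece⊆H i))
    where
    covers : ∀ x y → Adj H x y → ∃ λ i → Adj (Gs i ∩ G₂) x y
    covers = union-intersection-covers {Gs = Gs} {G₁} {G₂} {H} G₁≡⋃Gs H≡G₁∩G₂

    piece⊆H : ∀ i → IsSubgraph (Gs i ∩ G₂) H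
    piece⊆H i = IsIntersection-⊇ {Gs i} {G₁} {G₂} {H} H≡G₁∩G₂ (IsUnion-⊇ {Gs = Gs} {G₁} G₁≡⋃Gs i)

theorem3p1 : (𝒞 : Graph → Set) → IsGraphClass 𝒞 → DecomposableClass 𝒞 →
    IntersectionwiseChiGuarding 𝒞
theorem3p1 𝒞 _ (t , k , r , _ , _ , 2≤r , decomposable) ℬ (hereditary , _) (f , f-mono , χ≤f) =
  f′ , f′-mono , χ≤f′
  where
  f′ : ℕ → ℕ
  f′ w = suc (k * f (ram (suc w) r)) ^ t

  f′-mono : NonDecreasing f′
  f′-mono m n m≤n = ^-monoˡ-≤ t (s≤s (*-monoʳ-≤ k (f-mono _ _ (ram-monoˡ r _ _ (s≤s m≤n)))))

  χ≤f′ : ∀ H → GraphIntersection 𝒞 ℬ H → ∀ w → IsCliqueNumber H w → Colourable H (f′ w)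
  χ≤f′ H (G₁ , G₂ , G₁∈𝒞 , G₂∈ℬ , H≡G₁∩G₂) w (_ , ω≤w) =
    colourable-decomposable-∩-ℬ hereditary f f-mono χ≤f {G₁ = G₁} {G₂} {H}
      (<⇒≤ 2≤r) (decomposable G₁ G₁∈𝒞) G₂∈ℬ H≡G₁∩G₂ ω≤w
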